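{- Let $P=([r],\preceq)$ be an increasing poset and $n_1,\dots,n_r\in\mathbb{N}$ satisfy (a) $n=n_1\cdots n_r$, (b) $n_i\ge2$ for all $i$, (c) $\gcd(n_i,n_j)=1$ for all $i,j\in[r]$ with $i\not\preceq j$. Then the set $L=\{\prod_{j\in[r]\setminus J}n_j : J\subseteq[r] \text{ ancestral}\}$ is a sublattice of $L(n)$.
   Context: $[r]=\{1,\dots,r\}$; $([r],\preceq)$ is increasing if $i\preceq j$ implies $i\le j$; $J\subseteq[r]$ is ancestral if $i\in J$, $i\preceq j$ imply $j\in J$. An empty product equals $1$. $L(n)$ is the lattice of positive divisors of $n$ ordered by divisibility, with meet $\gcd$ and join $\mathrm{lcm}$; a sublattice is a subset closed under $\gcd$ and $\mathrm{lcm}$. -}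

module Defs where

open import Data.Nat using (ℕ; _*_; _≤_; _<_)
open import Data.Nat.GCD using (gcd)
open import Data.Nat.LCM using (lcm)
open import Data.Nat.Divisibility using (_∣_)
open import Data.Fin using (Fin; zero; suc; toℕ)
open import Data.Fin.Subset using (Subset; _∈_)
open import Data.Vec using (_∷_; [])
open import Data.Bool using (true; false)
open import Data.Product using (Σ; _×_)
open import Relation.Binary.PropositionalEquality using (_≡_)
open import Relation.Binary using (Rel; IsPartialOrder)
open import Level using (0ℓ)

∏ : ∀ {r} → (Fin r → ℕ) → ℕ
∏ {ℕ.zero}  n = 1
∏ {ℕ.suc r} n = n zero * ∏ (λ i → n (suc i))

∏Outside : ∀ {r} → (Fin r → ℕ) → Subset r → ℕ
∏Outside n []          = 1
∏Outside n (true  ∷ J) = ∏Outside (λ i → n (suc i)) J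
∏Outside n (false ∷ J) = n zero * ∏Outside (λ i → n (suc i)) J

Increasing : ∀ {r} → Rel (Fin r) 0ℓ → Set
Increasing _≼_ = ∀ {i j} → i ≼ j → toℕ i ≤ toℕ j

Ancestral : ∀ {r} → Rel (Fin r) 0ℓ → Subset r → Set
Ancestral _≼_ J = ∀ {i j} → i ∈ J → i ≼ j → j ∈ J

InL : ∀ {r} → Rel (Fin r) 0ℓ → (Fin r → ℕ) → ℕ → Set
InL _≼_ n m = Σ (Subset _) (λ J → Ancestral _≼_ J × (m ≡ ∏Outside n J))

IsSublatticeOfDivisors : ℕ → (ℕ → Set) → Set
IsSublatticeOfDivisors n S =
  (∀ {a} → S a → 0 < a × a ∣ n) ×
  (∀ {a b} → S a → S b → S (gcd a b)) ×
  (∀ {a b} → S a → S b → S (lcm a b))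

-- Write ∏Outside n J as the product over the complement ∁ J.  For two such
-- index sets A = ∁ J and B = ∁ K the products factor as D·X and D·Y, where D
-- is the product over A ∩ B and X, Y are the products over A ─ B and B ─ A.
-- An index of A ─ B lies in K and an index of B ─ A does not, so when K is
-- ancestral the former is never below the latter; by hypothesis (c) X and Y
-- are then coprime.  Hence gcd = D = ∏Outside (J ∪ K), and from gcd·lcm = D·X·D·Y
-- the lcm is D·X·Y, the product over A ∪ B = ∁ (J ∩ K).  Ancestral sets are
-- closed under ∪ and ∩, so L is closed under gcd and lcm.
module Submission where

open import Defs
open import Data.Bool using (true; false; not)
open import Data.Fin using (Fin; zero; suc)
open import Data.Fin.Subset using (Subset; _∈_; _∉_; _∪_; _∩_; _─_; ∁)
open import Data.Fin.Subset.Properties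
  using (x∈p∪q⁺; x∈p∪q⁻; x∈p∩q⁺; x∈p∩q⁻; ∩-comm; drop-there; x∈∁p⇒x∉p; x∉∁p⇒x∈p)
open import Data.Nat using (ℕ; _≤_; _*_; _<_; z<s; NonZero; >-nonZero; >-nonZero⁻¹)
open import Data.Nat.Properties
  using (*-assoc; *-identityʳ; *-cancelˡ-≡; m*n≢0; <-≤-trans; *-commutativeSemigroup)
open import Data.Nat.GCD using (gcd; c*gcd[m,n]≡gcd[cm,cn])
open import Data.Nat.LCM using (lcm; gcd*lcm)
open import Data.Nat.Divisibility using (_∣_; ∣-refl; ∣-trans; ∣1⇒≡1; n∣m*n; *-monoʳ-∣)
open import Data.Nat.Coprimality as Coprime
  using (Coprime; gcd≡1⇒coprime; coprime⇒gcd≡1; coprime-divisor)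
open import Data.Product using (_×_; _,_)
open import Data.Sum using (inj₁; inj₂)
open import Data.Vec using ([]; _∷_; here; there)
open import Function using (_∘_)
open import Relation.Nullary using (¬_)
open import Relation.Binary.PropositionalEquality
  using (_≡_; refl; sym; trans; cong; cong₂; module ≡-Reasoning)
open import Relation.Binary using (Rel; IsPartialOrder)
open import Level using (0ℓ)

open import Algebra.Properties.CommutativeSemigroup *-commutativeSemigroup
  using (interchange; x∙yz≈y∙xz)

∏Inside : ∀ {r} → (Fin r → ℕ) → Subset r → ℕ
∏Inside n []          = 1
∏Inside n (true  ∷ S) = n zero * ∏Inside (n ∘ suc) S
∏Inside n (false ∷ S) = ∏Inside (n ∘ suc) S

∏Outside≡∏Inside∁ : ∀ {r} (n : Fin r → ℕ) J → ∏Outside n J ≡ ∏Inside n (∁ J)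
∏Outside≡∏Inside∁ n []          = refl
∏Outside≡∏Inside∁ n (true  ∷ J) = ∏Outside≡∏Inside∁ (n ∘ suc) J
∏Outside≡∏Inside∁ n (false ∷ J) = cong (n zero *_) (∏Outside≡∏Inside∁ (n ∘ suc) J)

∏Inside∣∏ : ∀ {r} (n : Fin r → ℕ) S → ∏Inside n S ∣ ∏ n
∏Inside∣∏ n []          = ∣-refl
∏Inside∣∏ n (true  ∷ S) = *-monoʳ-∣ (n zero) (∏Inside∣∏ (n ∘ suc) S)
∏Inside∣∏ n (false ∷ S) = ∣-trans (∏Inside∣∏ (n ∘ suc) S) (n∣m*n (n zero))

∏Inside-nonZero : ∀ {r} (n : Fin r → ℕ) → (∀ i → NonZero (n i)) → ∀ S → NonZero (∏Inside n S)
∏Inside-nonZero n nz []          = _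
∏Inside-nonZero n nz (true  ∷ S) =
  m*n≢0 _ _ {{nz zero}} {{∏Inside-nonZero (n ∘ suc) (nz ∘ suc) S}}
∏Inside-nonZero n nz (false ∷ S) = ∏Inside-nonZero (n ∘ suc) (nz ∘ suc) S

∏Inside-∩-─ : ∀ {r} (n : Fin r → ℕ) S T →
              ∏Inside n S ≡ ∏Inside n (S ∩ T) * ∏Inside n (S ─ T)
∏Inside-∩-─ n []          []          = refl
∏Inside-∩-─ n (true  ∷ S) (true  ∷ T) =
  trans (cong (n zero *_) (∏Inside-∩-─ (n ∘ suc) S T))
        (sym (*-assoc (n zero) (∏Inside (n ∘ suc) (S ∩ T)) (∏Inside (n ∘ suc) (S ─ T))))
∏Inside-∩-─ n (true  ∷ S) (false ∷ T) =
  trans (cong (n zero *_) (∏Inside-∩-─ (n ∘ suc) S T))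
        (x∙yz≈y∙xz (n zero) (∏Inside (n ∘ suc) (S ∩ T)) (∏Inside (n ∘ suc) (S ─ T)))
∏Inside-∩-─ n (false ∷ S) (true  ∷ T) = ∏Inside-∩-─ (n ∘ suc) S T
∏Inside-∩-─ n (false ∷ S) (false ∷ T) = ∏Inside-∩-─ (n ∘ suc) S T

∏Inside-∩-∪ : ∀ {r} (n : Fin r → ℕ) S T →
              ∏Inside n (S ∩ T) * ∏Inside n (S ∪ T) ≡ ∏Inside n S * ∏Inside n T
∏Inside-∩-∪ n []          []          = refl
∏Inside-∩-∪ n (true  ∷ S) (true  ∷ T) = begin
  (x * a) * (x * b)  ≡⟨ interchange x a x b ⟩
  (x * x) * (a * b)  ≡⟨ cong ((x * x) *_) (∏Inside-∩-∪ (n ∘ suc) S T) ⟩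
  (x * x) * (s * t)  ≡⟨ interchange x x s t ⟩
  (x * s) * (x * t)  ∎
  where
  open ≡-Reasoning
  x = n zero
  a = ∏Inside (n ∘ suc) (S ∩ T)
  b = ∏Inside (n ∘ suc) (S ∪ T)
  s = ∏Inside (n ∘ suc) S
  t = ∏Inside (n ∘ suc) T
∏Inside-∩-∪ n (true  ∷ S) (false ∷ T) = begin
  a * (x * b)  ≡⟨ x∙yz≈y∙xz a x b ⟩
  x * (a * b)  ≡⟨ cong (x *_) (∏Inside-∩-∪ (n ∘ suc) S T) ⟩
  x * (s * t)  ≡⟨ *-assoc x s t ⟨
  (x * s) * t  ∎
  where
  open ≡-Reasoning
  x = n zero
  a = ∏Inside (n ∘ suc) (S ∩ T)
  b = ∏Inside (n ∘ suc) (S ∪ T)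
  s = ∏Inside (n ∘ suc) S
  t = ∏Inside (n ∘ suc) T
∏Inside-∩-∪ n (false ∷ S) (true  ∷ T) = begin
  a * (x * b)  ≡⟨ x∙yz≈y∙xz a x b ⟩
  x * (a * b)  ≡⟨ cong (x *_) (∏Inside-∩-∪ (n ∘ suc) S T) ⟩
  x * (s * t)  ≡⟨ x∙yz≈y∙xz x s t ⟩
  s * (x * t)  ∎
  where
  open ≡-Reasoning
  x = n zero
  a = ∏Inside (n ∘ suc) (S ∩ T)
  b = ∏Inside (n ∘ suc) (S ∪ T)
  s = ∏Inside (n ∘ suc) S
  t = ∏Inside (n ∘ suc) T
∏Inside-∩-∪ n (false ∷ S) (false ∷ T) = ∏Inside-∩-∪ (n ∘ suc) S T

coprime-* : ∀ {c a b} → Coprime c a → Coprime c b → Coprime c (a * b)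
coprime-* c⊥a c⊥b (d∣c , d∣ab) =
  c⊥b (d∣c , coprime-divisor (λ (e∣d , e∣a) → c⊥a (∣-trans e∣d d∣c , e∣a)) d∣ab)

coprime-1 : ∀ c → Coprime c 1
coprime-1 c (_ , d∣1) = ∣1⇒≡1 d∣1

∏Inside-coprime : ∀ {r} c (n : Fin r → ℕ) S →
                  (∀ {i} → i ∈ S → Coprime c (n i)) → Coprime c (∏Inside n S)
∏Inside-coprime c n []          h = coprime-1 c
∏Inside-coprime c n (true  ∷ S) h =
  coprime-* (h here) (∏Inside-coprime c (n ∘ suc) S (h ∘ there))
∏Inside-coprime c n (false ∷ S) h = ∏Inside-coprime c (n ∘ suc) S (h ∘ there)

x∈p─q⇒x∈p∧x∉q : ∀ {r} (p q : Subset r) {x} → x ∈ p ─ q → x ∈ p × x ∉ q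
x∈p─q⇒x∈p∧x∉q (true  ∷ p) (false ∷ q) here = here , λ ()
x∈p─q⇒x∈p∧x∉q (false ∷ p) (false ∷ q) {zero} ()
x∈p─q⇒x∈p∧x∉q (_     ∷ p) (true  ∷ q) {zero} ()
x∈p─q⇒x∈p∧x∉q (_     ∷ p) (_     ∷ q) (there x∈) with x∈p─q⇒x∈p∧x∉q p q x∈
... | x∈p , x∉q = there x∈p , x∉q ∘ drop-there

gcd[d*x,d*y]≡d : ∀ d {x y} → Coprime x y → gcd (d * x) (d * y) ≡ d
gcd[d*x,d*y]≡d d {x} {y} x⊥y = begin
  gcd (d * x) (d * y)  ≡⟨ c*gcd[m,n]≡gcd[cm,cn] d x y ⟨
  d * gcd x y          ≡⟨ cong (d *_) (coprime⇒gcd≡1 x⊥y) ⟩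
  d * 1                ≡⟨ *-identityʳ d ⟩
  d                    ∎
  where open ≡-Reasoning

Separated : ∀ {r} → (Fin r → ℕ) → Subset r → Subset r → Set
Separated n S T = ∀ {i j} → i ∈ S ─ T → j ∈ T ─ S → Coprime (n i) (n j)

module _ {r} (n : Fin r → ℕ) (S T : Subset r) (sep : Separated n S T) where

  gcd-∏Inside : gcd (∏Inside n S) (∏Inside n T) ≡ ∏Inside n (S ∩ T)
  gcd-∏Inside = begin
    gcd (∏Inside n S) (∏Inside n T)
      ≡⟨ cong₂ gcd (∏Inside-∩-─ n S T) (∏Inside-∩-─ n T S) ⟩
    gcd (∏Inside n (S ∩ T) * ∏Inside n (S ─ T)) (∏Inside n (T ∩ S) * ∏Inside n (T ─ S))
      ≡⟨ cong (λ U → gcd (∏Inside n (S ∩ T) * ∏Inside n (S ─ T)) (∏Inside n U * ∏Inside n (T ─ S)))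
              (∩-comm T S) ⟩
    gcd (∏Inside n (S ∩ T) * ∏Inside n (S ─ T)) (∏Inside n (S ∩ T) * ∏Inside n (T ─ S))
      ≡⟨ gcd[d*x,d*y]≡d (∏Inside n (S ∩ T)) coprime-parts ⟩
    ∏Inside n (S ∩ T) ∎
    where
    open ≡-Reasoning
    coprime-parts : Coprime (∏Inside n (S ─ T)) (∏Inside n (T ─ S))
    coprime-parts = ∏Inside-coprime _ n (T ─ S) λ {j} j∈ →
      Coprime.sym (∏Inside-coprime (n j) n (S ─ T) λ i∈ → Coprime.sym (sep i∈ j∈))

  lcm-∏Inside : (∀ i → NonZero (n i)) → lcm (∏Inside n S) (∏Inside n T) ≡ ∏Inside n (S ∪ T)
  lcm-∏Inside nz = *-cancelˡ-≡ _ _ (∏Inside n (S ∩ T)) {{∏Inside-nonZero n nz (S ∩ T)}} (begin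
    ∏Inside n (S ∩ T) * lcm (∏Inside n S) (∏Inside n T)
      ≡⟨ cong (_* lcm (∏Inside n S) (∏Inside n T)) gcd-∏Inside ⟨
    gcd (∏Inside n S) (∏Inside n T) * lcm (∏Inside n S) (∏Inside n T)
      ≡⟨ gcd*lcm (∏Inside n S) (∏Inside n T) ⟩
    ∏Inside n S * ∏Inside n T
      ≡⟨ ∏Inside-∩-∪ n S T ⟨
    ∏Inside n (S ∩ T) * ∏Inside n (S ∪ T) ∎)
    where open ≡-Reasoning

∁-∪ : ∀ {r} (p q : Subset r) → ∁ (p ∪ q) ≡ ∁ p ∩ ∁ q
∁-∪ []          []      = refl
∁-∪ (true  ∷ p) (_ ∷ q) = cong (false ∷_) (∁-∪ p q)
∁-∪ (false ∷ p) (y ∷ q) = cong (not y ∷_) (∁-∪ p q)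

∁-∩ : ∀ {r} (p q : Subset r) → ∁ (p ∩ q) ≡ ∁ p ∪ ∁ q
∁-∩ []          []      = refl
∁-∩ (true  ∷ p) (y ∷ q) = cong (not y ∷_) (∁-∩ p q)
∁-∩ (false ∷ p) (_ ∷ q) = cong (true ∷_) (∁-∩ p q)

module _ {r} {_≼_ : Rel (Fin r) 0ℓ} where

  ∪-ancestral : ∀ {J K} → Ancestral _≼_ J → Ancestral _≼_ K → Ancestral _≼_ (J ∪ K)
  ∪-ancestral {J} {K} aJ aK i∈ i≼j with x∈p∪q⁻ J K i∈
  ... | inj₁ i∈J = x∈p∪q⁺ (inj₁ (aJ i∈J i≼j))
  ... | inj₂ i∈K = x∈p∪q⁺ (inj₂ (aK i∈K i≼j))

  ∩-ancestral : ∀ {J K} → Ancestral _≼_ J → Ancestral _≼_ K → Ancestral _≼_ (J ∩ K)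
  ∩-ancestral {J} {K} aJ aK i∈ i≼j with x∈p∩q⁻ J K i∈
  ... | i∈J , i∈K = x∈p∩q⁺ (aJ i∈J i≼j , aK i∈K i≼j)

  ∁-separated : ∀ {n : Fin r → ℕ} → (∀ i j → ¬ i ≼ j → Coprime (n i) (n j)) →
                ∀ J {K} → Ancestral _≼_ K → Separated n (∁ J) (∁ K)
  ∁-separated incomparable⇒coprime J {K} aK {i} {j} i∈ j∈ =
    incomparable⇒coprime i j λ i≼j → x∈∁p⇒x∉p j∈∁K (aK i∈K i≼j)
    where
    i∈K : i ∈ K
    i∈K with x∈p─q⇒x∈p∧x∉q (∁ J) (∁ K) i∈
    ... | _ , i∉∁K = x∉∁p⇒x∈p i∉∁K
    j∈∁K : j ∈ ∁ K
    j∈∁K with x∈p─q⇒x∈p∧x∉q (∁ K) (∁ J) j∈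
    ... | j∈∁K , _ = j∈∁K

lemma10p2 : (r : ℕ) (_≼_ : Rel (Fin r) 0ℓ) → IsPartialOrder _≡_ _≼_ → Increasing _≼_ →
    (n : ℕ) (ns : Fin r → ℕ) → n ≡ ∏ ns → (∀ i → 2 ≤ ns i) →
    (∀ i j → ¬ (i ≼ j) → gcd (ns i) (ns j) ≡ 1) →
    IsSublatticeOfDivisors n (InL _≼_ ns)
lemma10p2 r _≼_ _ _ n ns refl 2≤ns gcd≡1 = positive-divisor , gcd-closed , lcm-closed
  where
  open ≡-Reasoning
  nonZero : ∀ i → NonZero (ns i)
  nonZero i = >-nonZero (<-≤-trans z<s (2≤ns i))

  separated : ∀ J {K} → Ancestral _≼_ K → Separated ns (∁ J) (∁ K)
  separated = ∁-separated λ i j i⋠j → gcd≡1⇒coprime (gcd≡1 i j i⋠j)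

  positive-divisor : ∀ {a} → InL _≼_ ns a → 0 < a × a ∣ ∏ ns
  positive-divisor (J , _ , refl) rewrite ∏Outside≡∏Inside∁ ns J =
    >-nonZero⁻¹ _ {{∏Inside-nonZero ns nonZero (∁ J)}} , ∏Inside∣∏ ns (∁ J)

  gcd-closed : ∀ {a b} → InL _≼_ ns a → InL _≼_ ns b → InL _≼_ ns (gcd a b)
  gcd-closed (J , aJ , refl) (K , aK , refl) = J ∪ K , ∪-ancestral aJ aK , (begin
    gcd (∏Outside ns J) (∏Outside ns K)
      ≡⟨ cong₂ gcd (∏Outside≡∏Inside∁ ns J) (∏Outside≡∏Inside∁ ns K) ⟩
    gcd (∏Inside ns (∁ J)) (∏Inside ns (∁ K))
      ≡⟨ gcd-∏Inside ns (∁ J) (∁ K) (separated J aK) ⟩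
    ∏Inside ns (∁ J ∩ ∁ K)  ≡⟨ cong (∏Inside ns) (∁-∪ J K) ⟨
    ∏Inside ns (∁ (J ∪ K))  ≡⟨ ∏Outside≡∏Inside∁ ns (J ∪ K) ⟨
    ∏Outside ns (J ∪ K)     ∎)

  lcm-closed : ∀ {a b} → InL _≼_ ns a → InL _≼_ ns b → InL _≼_ ns (lcm a b)
  lcm-closed (J , aJ , refl) (K , aK , refl) = J ∩ K , ∩-ancestral aJ aK , (begin
    lcm (∏Outside ns J) (∏Outside ns K)
      ≡⟨ cong₂ lcm (∏Outside≡∏Inside∁ ns J) (∏Outside≡∏Inside∁ ns K) ⟩
    lcm (∏Inside ns (∁ J)) (∏Inside ns (∁ K))
      ≡⟨ lcm-∏Inside ns (∁ J) (∁ K) (separated J aK) nonZero ⟩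
    ∏Inside ns (∁ J ∪ ∁ K)  ≡⟨ cong (∏Inside ns) (∁-∩ J K) ⟨
    ∏Inside ns (∁ (J ∩ K))  ≡⟨ ∏Outside≡∏Inside∁ ns (J ∩ K) ⟨
    ∏Outside ns (J ∩ K)     ∎)
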